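{- Let $n\ge1$, let $x_1,\dots,x_n$ be distinct integers greater than $1$, and let $D=\{1,0,x_1,\dots,x_n\}$. Then $\sigma(D)=4-n+\sum_{i=1}^n x_i$.
   Context: A signed tree is a pair $(T,s)$ with $T$ a finite tree and $s:E(T)\to\{+,-\}$. The signed degree $sdeg(v)$ of a vertex is the number of incident positive edges minus the number of incident negative edges. $(T,s)$ realizes $D$ if $D=\{sdeg(v):v\in V(T)\}$. $\sigma(D)$ is the minimum number of vertices of a tree $T$ such that some signed tree $(T,s)$ realizes $D$. -}

module Defs where

open import Data.Nat using (ℕ; zero; suc; _≤_; _<_; _+_)
open import Data.Integer using (ℤ; +_; 0ℤ; 1ℤ; -[1+_])
import Data.Integer as ℤ
open import Data.Fin using (Fin)
open import Data.List using (List; []; _∷_; map; foldr; length)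
open import Data.List.Relation.Unary.AllPairs using (AllPairs)
open import Data.Vec.Functional using (Vector)
open import Data.Fin.Base using ()
open import Data.Maybe using (Maybe; just; nothing)
open import Data.Product using (Σ; ∃; ∃-syntax; _×_; _,_)
open import Data.Sum using (_⊎_)
open import Data.Empty using (⊥)
open import Relation.Nullary using (¬_)
open import Relation.Binary.PropositionalEquality using (_≡_; _≢_)
open import Data.List using (allFin)

data Sign : Set where
  pos neg : Sign

signValue : Sign → ℤ
signValue pos = 1ℤ
signValue neg = ℤ.- 1ℤ

-- A finite simple graph on vertex set Fin m whose edges carry a sign:
-- edge i j = nothing means no edge, edge i j = just s means an edge of sign s.
record SignedGraph (m : ℕ) : Set where
  field
    edge      : Fin m → Fin m → Maybe Sign
    symmetric : ∀ i j → edge i j ≡ edge j i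
    loopless  : ∀ i → edge i i ≡ nothing

open SignedGraph public

Adj : ∀ {m} → SignedGraph m → Fin m → Fin m → Set
Adj G i j = ∃[ s ] (edge G i j ≡ just s)

data Walk {m} (G : SignedGraph m) : Fin m → Fin m → Set where
  here : ∀ v → Walk G v v
  step : ∀ {u v w} → Adj G u v → Walk G v w → Walk G u w

Connected : ∀ {m} → SignedGraph m → Set
Connected G = ∀ i j → Walk G i j

data Chain {m} (G : SignedGraph m) : List (Fin m) → Set where
  nil  : Chain G []
  one  : ∀ v → Chain G (v ∷ [])
  cons : ∀ {u v vs} → Adj G u v → Chain G (v ∷ vs) → Chain G (u ∷ v ∷ vs)

-- A cycle: distinct vertices v₀,…,vₖ with k ≥ 2 (at least 3 vertices),
-- consecutive ones adjacent and vₖ adjacent to v₀.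
record Cycle {m} (G : SignedGraph m) : Set where
  field
    first    : Fin m
    middle   : List (Fin m)
    last     : Fin m
    long     : 1 ≤ length middle
    distinct : AllPairs _≢_ (first ∷ middle Data.List.++ (last ∷ []))
    chain    : Chain G (first ∷ middle Data.List.++ (last ∷ []))
    closing  : Adj G last first

Acyclic : ∀ {m} → SignedGraph m → Set
Acyclic G = ¬ Cycle G

record SignedTree (m : ℕ) : Set where
  field
    graph     : SignedGraph m
    connected : Connected graph
    acyclic   : Acyclic graph

open SignedTree public

contrib : Maybe Sign → ℤ
contrib nothing  = 0ℤ
contrib (just s) = signValue s

sdeg : ∀ {m} → SignedGraph m → Fin m → ℤ
sdeg {m} G v = foldr ℤ._+_ 0ℤ (map (λ w → contrib (edge G v w)) (allFin m))

Realizes : ∀ {m} → SignedTree m → (ℤ → Set) → Set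
Realizes T D = (∀ v → D (sdeg (graph T) v)) × (∀ d → D d → ∃[ v ] (sdeg (graph T) v ≡ d))

σ-is : (ℤ → Set) → ℕ → Set
σ-is D k = (Σ (SignedTree k) λ T → Realizes T D)
         × (∀ m (T : SignedTree m) → Realizes T D → k ≤ m)

DSet : ∀ {n} → Vector ℕ n → ℤ → Set
DSet {n} x d = d ≡ 1ℤ ⊎ d ≡ 0ℤ ⊎ ∃[ i ] (d ≡ + (x i))

sumVec : ∀ {n} → Vector ℕ n → ℕ
sumVec {n} x = foldr _+_ 0 (map x (allFin n))

-- In a tree realizing D every signed degree is nonnegative, so a vertex v with
-- sdeg v = k and n_v incident negative edges has degree k + 2 n_v ≥ max(1, k) + n_v.  The vertex
-- of signed degree 0 carries a negative edge, so Σ n_v ≥ 2, and the vertices of signed degree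
-- x₁, …, xₙ are distinct.  Summing, 2(|V| − 1) = Σ deg v ≥ |V| + Σ (xᵢ − 1) + 2, i.e.
-- |V| ≥ 4 + Σ (xᵢ − 1).  The path with edge signs +, −, + realizes {1, 0}; for each xᵢ, hang xᵢ − 2
-- positive pendant edges on its last vertex and continue the path by one more positive edge.
-- That vertex then has signed degree xᵢ, and each step adds xᵢ − 1 vertices.
module Submission where

open import Defs
open import Algebra.Properties.CommutativeSemigroup using (interchange)
open import Data.Empty using (⊥; ⊥-elim)
open import Data.Fin using (Fin; zero; suc; _≟_)
import Data.Fin.Properties as Fin
open import Data.Integer using (ℤ; +_; 0ℤ; 1ℤ; ∣_∣)
import Data.Integer as ℤ
import Data.Integer.Properties as ℤ
open import Data.Integer.Tactic.RingSolver using (solve-∀)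
open import Data.List using (List; []; _∷_; map; foldr; length; _++_; [_]; allFin; tabulate)
open import Data.List.Membership.Propositional using (_∈_; find; lose)
open import Data.List.Membership.Propositional.Properties using (∈-∃++; ∈-allFin; ∈-++⁺ˡ; ∈-++⁺ʳ)
open import Data.List.Properties
  using (map-∘; ++-assoc; length-tabulate; ∷ʳ-injective; length-map; map-++; map-tabulate)
open import Data.List.Relation.Binary.Permutation.Propositional using (_↭_; ↭⇒↭ₛ)
open import Data.List.Relation.Binary.Permutation.Propositional.Properties
  using (map⁺; shift; ∈-resp-↭; ↭-length)
open import Data.List.Relation.Binary.Permutation.Setoid.Properties using (Unique-resp-↭)
open import Data.List.Relation.Binary.Subset.Propositional using (_⊆_)
open import Data.List.Relation.Unary.All using (All; []; _∷_)
import Data.List.Relation.Unary.All as All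
open import Data.List.Relation.Unary.All.Properties using (++⁻ˡ; ++⁻ʳ; ¬Any⇒All¬)
open import Data.List.Relation.Unary.AllPairs using ([]; _∷_)
open import Data.List.Relation.Unary.Any using (here; there; any?)
open import Data.List.Relation.Unary.Unique.Propositional using (Unique)
import Data.List.Relation.Unary.Unique.Propositional.Properties as Unique
open import Data.Maybe using (Maybe; just; nothing)
open import Data.Nat using (ℕ; zero; suc; _≤_; _<_; _+_; _∸_; _*_; z≤n; s≤s)
open import Data.Nat.ListAction using (sum)
open import Data.Nat.ListAction.Properties using (sum-↭)
open import Data.Nat.Properties hiding (_≟_)
open import Data.Nat.Tactic.RingSolver using () renaming (solve-∀ to solve-∀ℕ)
open import Data.Product using (Σ; ∃-syntax; ∃₂; _×_; _,_; proj₁; proj₂)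
open import Data.Sum using (_⊎_; inj₁; inj₂)
open import Data.Vec.Functional using (Vector)
open import Function using (_∘_; id)
open import Function.Definitions using (Injective)
open import Relation.Binary.PropositionalEquality hiding ([_])
open import Relation.Nullary using (¬_; Dec; yes; no; ¬?; _×-dec_)

∑ : {A : Set} → List A → (A → ℕ) → ℕ
∑ xs f = sum (map f xs)

module _ {A : Set} where

  ∑-cong : ∀ xs {f g : A → ℕ} → (∀ v → f v ≡ g v) → ∑ xs f ≡ ∑ xs g
  ∑-cong []       f≗g = refl
  ∑-cong (x ∷ xs) f≗g = cong₂ _+_ (f≗g x) (∑-cong xs f≗g)

  ∑-+ : ∀ xs (f g : A → ℕ) → ∑ xs (λ v → f v + g v) ≡ ∑ xs f + ∑ xs g
  ∑-+ []       f g = refl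
  ∑-+ (x ∷ xs) f g = trans (cong (λ s → f x + g x + s) (∑-+ xs f g))
                           (interchange +-commutativeSemigroup (f x) (g x) (∑ xs f) (∑ xs g))

  ∑-mono-≤ : ∀ xs {f g : A → ℕ} → (∀ v → f v ≤ g v) → ∑ xs f ≤ ∑ xs g
  ∑-mono-≤ []       f≤g = z≤n
  ∑-mono-≤ (x ∷ xs) f≤g = +-mono-≤ (f≤g x) (∑-mono-≤ xs f≤g)

  ∑-map : ∀ {B : Set} (h : B → A) xs (f : A → ℕ) → ∑ (map h xs) f ≡ ∑ xs (f ∘ h)
  ∑-map h xs f = cong sum (sym (map-∘ xs))

  ∑-1≡length : ∀ (xs : List A) → ∑ xs (λ _ → 1) ≡ length xs
  ∑-1≡length []       = refl
  ∑-1≡length (x ∷ xs) = cong suc (∑-1≡length xs)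

  ∑-∸1+length : ∀ xs (f : A → ℕ) → (∀ v → 0 < f v) → ∑ xs (λ v → f v ∸ 1) + length xs ≡ ∑ xs f
  ∑-∸1+length xs f 0<f = begin
    ∑ xs (λ v → f v ∸ 1) + length xs       ≡⟨ cong (λ s → ∑ xs (λ v → f v ∸ 1) + s) (∑-1≡length xs) ⟨
    ∑ xs (λ v → f v ∸ 1) + ∑ xs (λ _ → 1)  ≡⟨ ∑-+ xs (λ v → f v ∸ 1) (λ _ → 1) ⟨
    ∑ xs (λ v → f v ∸ 1 + 1)               ≡⟨ ∑-cong xs (λ v → m∸n+n≡m (0<f v)) ⟩
    ∑ xs f                                 ∎
    where open ≡-Reasoning

  ∑-↭ : ∀ {xs ys} (f : A → ℕ) → xs ↭ ys → ∑ xs f ≡ ∑ ys f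
  ∑-↭ f xs↭ys = sum-↭ (map⁺ f xs↭ys)

  ∈⇒≤∑ : ∀ {xs v} (f : A → ℕ) → v ∈ xs → f v ≤ ∑ xs f
  ∈⇒≤∑          f (here refl)  = m≤m+n _ _
  ∈⇒≤∑ {x ∷ xs} f (there v∈xs) = ≤-trans (∈⇒≤∑ f v∈xs) (m≤n+m _ (f x))

  ∑-pos : ∀ xs (f : A → ℕ) → 0 < ∑ xs f → ∃[ v ] (v ∈ xs × 0 < f v)
  ∑-pos (x ∷ xs) f 0<∑ with f x in fx≡
  ... | suc _ = x , here refl , subst (0 <_) (sym fx≡) (s≤s z≤n)
  ... | zero  = let v , v∈xs , 0<fv = ∑-pos xs f 0<∑ in v , there v∈xs , 0<fv

  ∈⇒↭∷ : ∀ {xs} {v : A} → v ∈ xs → ∃[ ys ] (xs ↭ v ∷ ys)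
  ∈⇒↭∷ v∈xs with ys , zs , refl ← ∈-∃++ v∈xs = ys ++ zs , shift _ ys zs

  Unique-tail-↭ : ∀ {xs ys} {v : A} → Unique xs → xs ↭ v ∷ ys → Unique ys
  Unique-tail-↭ uniq xs↭ with _ ∷ uniq′ ← Unique-resp-↭ (setoid A) (↭⇒↭ₛ xs↭) uniq = uniq′

  Unique-++⁻ˡ : ∀ xs {ys : List A} → Unique (xs ++ ys) → Unique xs
  Unique-++⁻ˡ []       _            = []
  Unique-++⁻ˡ (x ∷ xs) (x∉ ∷ uniq) = ++⁻ˡ xs x∉ ∷ Unique-++⁻ˡ xs uniq

  Unique-++-disjoint : ∀ xs {ys} {p q : A} → Unique (xs ++ ys) → p ∈ xs → q ∈ ys → p ≢ q
  Unique-++-disjoint (x ∷ xs) (x∉ ∷ _)    (here refl) q∈ys = All.lookup x∉ (∈-++⁺ʳ xs q∈ys)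
  Unique-++-disjoint (x ∷ xs) (_ ∷ uniq) (there p∈)  q∈ys = Unique-++-disjoint xs uniq p∈ q∈ys

  ∑-mono-⊆ : ∀ {xs ys} (f : A → ℕ) → Unique xs → Unique ys → xs ⊆ ys → ∑ xs f ≤ ∑ ys f
  ∑-mono-⊆ {[]}          f _ _ _ = z≤n
  ∑-mono-⊆ {x ∷ xs} {ys} f (x∉xs ∷ uxs) uys xs⊆ys with ys′ , ys↭ ← ∈⇒↭∷ (xs⊆ys (here refl)) =
    subst (f x + ∑ xs f ≤_) (sym (∑-↭ f ys↭))
      (+-monoʳ-≤ (f x) (∑-mono-⊆ f uxs (Unique-tail-↭ uys ys↭) xs⊆ys′))
    where
    xs⊆ys′ : xs ⊆ ys′
    xs⊆ys′ v∈xs with ∈-resp-↭ ys↭ (xs⊆ys (there v∈xs))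
    ... | here refl   = ⊥-elim (All.lookup x∉xs v∈xs refl)
    ... | there v∈ys′ = v∈ys′

  ∑-concentrated : ∀ {xs} (f : A → ℕ) p → Unique xs → (∀ v → f v ≤ 1) →
                   (∀ {v} → v ∈ xs → 0 < f v → v ≡ p) → ∑ xs f ≤ 1
  ∑-concentrated {[]}     f p _ _ _ = z≤n
  ∑-concentrated {x ∷ xs} f p (x∉xs ∷ uxs) f≤1 supp with f x in fx≡
  ... | zero  = ∑-concentrated f p uxs f≤1 (supp ∘ there)
  ... | suc _ with ∑ xs f in ∑≡
  ...   | zero  = subst (_≤ 1) (trans fx≡ (sym (+-identityʳ _))) (f≤1 x)
  ...   | suc _ with v , v∈xs , 0<fv ← ∑-pos xs f (subst (0 <_) (sym ∑≡) (s≤s z≤n)) =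
    ⊥-elim (All.lookup x∉xs v∈xs
             (trans (supp (here refl) (subst (0 <_) (sym fx≡) (s≤s z≤n))) (sym (supp (there v∈xs) 0<fv))))

hasEdge : Maybe Sign → ℕ
hasEdge nothing  = 0
hasEdge (just _) = 1

hasEdge≤1 : ∀ e → hasEdge e ≤ 1
hasEdge≤1 nothing  = z≤n
hasEdge≤1 (just _) = s≤s z≤n

module _ {m} (G : SignedGraph m) where

  degIn : List (Fin m) → Fin m → ℕ
  degIn S v = ∑ S (hasEdge ∘ edge G v)

  deg : Fin m → ℕ
  deg = degIn (allFin m)

  Adj-sym : ∀ {i j} → Adj G i j → Adj G j i
  Adj-sym {i} {j} (s , eq) = s , trans (symmetric G j i) eq

  ¬Adj-refl : ∀ {i} → ¬ Adj G i i
  ¬Adj-refl {i} (s , eq) with () ← trans (sym (loopless G i)) eq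

  Adj? : ∀ i j → Dec (Adj G i j)
  Adj? i j with edge G i j
  ... | just s  = yes (s , refl)
  ... | nothing = no λ ()

  Adj⇒hasEdge : ∀ {i j} → Adj G i j → hasEdge (edge G i j) ≡ 1
  Adj⇒hasEdge (s , eq) rewrite eq = refl

  hasEdge⇒Adj : ∀ {i j} → 0 < hasEdge (edge G i j) → Adj G i j
  hasEdge⇒Adj {i} {j} 0<h with edge G i j
  ... | just s = s , refl

  Adj⇒0<deg : ∀ {i j} → Adj G i j → 0 < deg i
  Adj⇒0<deg {i} {j} adj = subst (_≤ deg i) (Adj⇒hasEdge adj) (∈⇒≤∑ (hasEdge ∘ edge G i) (∈-allFin j))

  Walk⇒Adj : ∀ {i j} → Walk G i j → i ≢ j → ∃[ u ] Adj G i u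
  Walk⇒Adj (here _)     i≢i = ⊥-elim (i≢i refl)
  Walk⇒Adj (step adj _) _   = _ , adj

  Walk-++ : ∀ {i j k} → Walk G i j → Walk G j k → Walk G i k
  Walk-++ (here _)      w₂ = w₂
  Walk-++ (step adj w₁) w₂ = step adj (Walk-++ w₁ w₂)

  connected⇒0<deg : Connected G → ∀ {i j} → i ≢ j → ∀ v → 0 < deg v
  connected⇒0<deg conn {i} {j} i≢j v with v ≟ i
  ... | yes refl = Adj⇒0<deg (proj₂ (Walk⇒Adj (conn v j) i≢j))
  ... | no  v≢i  = Adj⇒0<deg (proj₂ (Walk⇒Adj (conn v i) v≢i))

  Chain-tail : ∀ {x xs} → Chain G (x ∷ xs) → Chain G xs
  Chain-tail (one _)    = nil
  Chain-tail (cons _ c) = c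

  Chain-++⁻ˡ : ∀ xs {ys} → Chain G (xs ++ ys) → Chain G xs
  Chain-++⁻ˡ []           _              = nil
  Chain-++⁻ˡ (x ∷ [])     _              = one x
  Chain-++⁻ˡ (x ∷ y ∷ xs) (cons adj chn) = cons adj (Chain-++⁻ˡ (y ∷ xs) chn)

  Chain-before : ∀ x xs {y zs} → Chain G (x ∷ xs ++ y ∷ zs) → ∃[ p ] (p ∈ x ∷ xs × Adj G y p)
  Chain-before x []        (cons adj _) = x , here refl , Adj-sym adj
  Chain-before x (x′ ∷ xs) (cons _ chn) with p , p∈ , adj ← Chain-before x′ xs chn = p , there p∈ , adj

  Chain-after : ∀ xs {y z zs} → Chain G (xs ++ y ∷ z ∷ zs) → Adj G y z
  Chain-after []       (cons adj _) = adj
  Chain-after (x ∷ xs) chn          = Chain-after xs (Chain-tail chn)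

  cycleVertices : Cycle G → List (Fin m)
  cycleVertices C = Cycle.first C ∷ Cycle.middle C ++ [ Cycle.last C ]

  TwoNeighbours : Fin m → Set
  TwoNeighbours y = ∃₂ λ p q → p ≢ q × Adj G y p × Adj G y q

  interior-twoNeighbours : ∀ f ys {y z} zs → Unique (f ∷ ys ++ y ∷ z ∷ zs) →
                           Chain G (f ∷ ys ++ y ∷ z ∷ zs) → TwoNeighbours y
  interior-twoNeighbours f ys zs uniq chn with p , p∈ , adj ← Chain-before f ys chn =
    p , _ , Unique-++-disjoint (f ∷ ys) uniq p∈ (there (here refl)) , adj , Chain-after (f ∷ ys) chn

  last-twoNeighbours : ∀ f ys {y} → 1 ≤ length ys → Unique (f ∷ ys ++ [ y ]) →
                       Chain G (f ∷ ys ++ [ y ]) → Adj G y f → TwoNeighbours y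
  last-twoNeighbours f (y₁ ∷ ys) _ (f∉ ∷ _) (cons _ chn) closing
    with p , p∈ , adj ← Chain-before y₁ ys chn =
    p , f , (λ p≡f → All.lookup f∉ (∈-++⁺ˡ p∈) (sym p≡f)) , adj , closing

  closedChain-twoNeighbours : ∀ f mid l → 1 ≤ length mid → Unique (f ∷ mid ++ [ l ]) →
                              Chain G (f ∷ mid ++ [ l ]) → Adj G l f →
                              ∀ {y} → y ∈ f ∷ mid ++ [ l ] → TwoNeighbours y
  closedChain-twoNeighbours f (h ∷ t) l _ (_ ∷ h∉ ∷ _) (cons adj _) closing (here refl) =
    h , l , All.lookup h∉ (∈-++⁺ʳ t (here refl)) , adj , Adj-sym closing
  closedChain-twoNeighbours f mid l long uniq chn closing (there y∈) with ∈-∃++ y∈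
  ... | ys , z ∷ zs , split = interior-twoNeighbours f ys zs (subst (Unique ∘ (f ∷_)) split uniq)
                                                              (subst (Chain G ∘ (f ∷_)) split chn)
  ... | ys , [] , split with refl , refl ← ∷ʳ-injective mid ys split =
    last-twoNeighbours f mid long uniq chn closing

  cycle-twoNeighbours : (C : Cycle G) → ∀ {y} → y ∈ cycleVertices C → TwoNeighbours y
  cycle-twoNeighbours C = closedChain-twoNeighbours (Cycle.first C) (Cycle.middle C) (Cycle.last C)
                            (Cycle.long C) (Cycle.distinct C) (Cycle.chain C) (Cycle.closing C)

  -- Degree sums in acyclic graphs

  degIn-∷ : ∀ {S l S′} → S ↭ l ∷ S′ → ∀ v → degIn S v ≡ hasEdge (edge G v l) + degIn S′ v
  degIn-∷ S↭ v = ∑-↭ (hasEdge ∘ edge G v) S↭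

  ∑degIn-remove : ∀ {S l S′} → S ↭ l ∷ S′ →
                  ∑ S (degIn S) ≡ degIn S′ l + (degIn S′ l + ∑ S′ (degIn S′))
  ∑degIn-remove {S} {l} {S′} S↭ = begin
    ∑ S (degIn S)
      ≡⟨ ∑-↭ (degIn S) S↭ ⟩
    degIn S l + ∑ S′ (degIn S)
      ≡⟨ cong₂ _+_ (degIn-∷ S↭ l) (∑-cong S′ (degIn-∷ S↭)) ⟩
    hasEdge (edge G l l) + degIn S′ l + ∑ S′ (λ v → hasEdge (edge G v l) + degIn S′ v)
      ≡⟨ cong₂ _+_ (cong (λ e → hasEdge e + degIn S′ l) (loopless G l)) (∑-+ S′ _ (degIn S′)) ⟩
    degIn S′ l + (∑ S′ (λ v → hasEdge (edge G v l)) + ∑ S′ (degIn S′))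
      ≡⟨ cong (λ d → degIn S′ l + (d + ∑ S′ (degIn S′))) (∑-cong S′ (λ v → cong hasEdge (symmetric G v l))) ⟩
    degIn S′ l + (degIn S′ l + ∑ S′ (degIn S′))
      ∎
    where open ≡-Reasoning

  open import Data.List.Membership.DecPropositional (_≟_ {m}) using (_∈?_)

  module _ (acyclic : Acyclic G) where

    ¬path-closes : ∀ {e p rest w} → Unique (e ∷ p ∷ rest) → Chain G (e ∷ p ∷ rest) →
                   Adj G e w → w ∈ rest → ⊥
    ¬path-closes {e} {p} {rest} {w} uniq chn adj w∈rest
      with ys , zs , refl ← ∈-∃++ w∈rest = acyclic record
        { first    = e
        ; middle   = p ∷ ys
        ; last     = w
        ; long     = s≤s z≤n
        ; distinct = Unique-++⁻ˡ (e ∷ p ∷ ys ++ [ w ]) (subst Unique reassoc uniq)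
        ; chain    = Chain-++⁻ˡ (e ∷ p ∷ ys ++ [ w ]) (subst (Chain G) reassoc chn)
        ; closing  = Adj-sym adj
        }
      where
      reassoc : e ∷ p ∷ ys ++ w ∷ zs ≡ (e ∷ p ∷ ys ++ [ w ]) ++ zs
      reassoc = cong (λ l → e ∷ p ∷ l) (sym (++-assoc ys [ w ] zs))

    Leaf : List (Fin m) → Set
    Leaf S = ∃[ l ] (l ∈ S × degIn S l ≤ 1)

    neighbourOtherThan? : ∀ {S} → Unique S → ∀ e p →
                          (∃[ w ] (w ∈ S × Adj G e w × w ≢ p)) ⊎ degIn S e ≤ 1
    neighbourOtherThan? {S} uniq e p with any? (λ w → Adj? e w ×-dec ¬? (w ≟ p)) S
    ... | yes found = inj₁ (find found)
    ... | no ¬found = inj₂ (∑-concentrated (hasEdge ∘ edge G e) p uniq (hasEdge≤1 ∘ edge G e) only-p)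
      where
      only-p : ∀ {w} → w ∈ S → 0 < hasEdge (edge G e w) → w ≡ p
      only-p {w} w∈S 0<h with w ≟ p
      ... | yes w≡p = w≡p
      ... | no  w≢p = ⊥-elim (¬found (lose w∈S (hasEdge⇒Adj 0<h , w≢p)))

    -- The path e ∷ p ∷ rest is extended at e along an edge other than e p; acyclicity keeps it
    -- simple, so it runs out of vertices of S unless it stops at a leaf of S first.
    leaf-from-path : ∀ {S} → Unique S → ∀ fuel {e p rest} → Unique (e ∷ p ∷ rest) →
                     Chain G (e ∷ p ∷ rest) → (e ∷ p ∷ rest) ⊆ S →
                     length S < fuel + length (e ∷ p ∷ rest) → Leaf S
    leaf-from-path {S} uS zero {e} {p} {rest} uniq chn path⊆S |S|<|path| =
      ⊥-elim (<⇒≱ |S|<|path| (subst₂ _≤_ (∑-1≡length (e ∷ p ∷ rest)) (∑-1≡length S)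
                                         (∑-mono-⊆ (λ _ → 1) uniq uS path⊆S)))
    leaf-from-path {S} uS (suc fuel) {e} {p} {rest} uniq chn path⊆S |S|<
      with neighbourOtherThan? uS e p
    ... | inj₂ deg≤1 = e , path⊆S (here refl) , deg≤1
    ... | inj₁ (w , w∈S , adj , w≢p) with w ∈? (e ∷ p ∷ rest)
    ...   | yes (here refl)            = ⊥-elim (¬Adj-refl adj)
    ...   | yes (there (here w≡p))     = ⊥-elim (w≢p w≡p)
    ...   | yes (there (there w∈rest)) = ⊥-elim (¬path-closes uniq chn adj w∈rest)
    ...   | no w∉path = leaf-from-path uS fuel (¬Any⇒All¬ _ w∉path ∷ uniq) (cons (Adj-sym adj) chn)
                          (λ { (here refl) → w∈S ; (there v∈) → path⊆S v∈ })
                          (subst (length S <_) (sym (+-suc fuel _)) |S|<)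

    leaf-exists : ∀ {S v} → Unique S → v ∈ S → Leaf S
    leaf-exists {S} {v} uS v∈S with neighbourOtherThan? uS v v
    ... | inj₂ deg≤1 = v , v∈S , deg≤1
    ... | inj₁ (w , w∈S , adj , w≢v) =
      leaf-from-path uS (length S) ((w≢v ∷ []) ∷ [] ∷ []) (cons (Adj-sym adj) (one v))
        (λ { (here refl) → w∈S ; (there (here refl)) → v∈S })
        (m<m+n (length S) (s≤s z≤n))

    handshake-acyclic : ∀ k {S} → Unique S → length S ≡ suc k → ∑ S (degIn S) ≤ 2 * k
    handshake-acyclic zero {s ∷ []} uS _ rewrite loopless G s = z≤n
    handshake-acyclic (suc k) {S@(s ∷ _)} uS |S|≡
      with l , l∈S , degl≤1 ← leaf-exists uS (here refl) with S′ , S↭ ← ∈⇒↭∷ l∈S = begin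
      ∑ S (degIn S)                               ≡⟨ ∑degIn-remove S↭ ⟩
      degIn S′ l + (degIn S′ l + ∑ S′ (degIn S′)) ≤⟨ +-mono-≤ degS′l≤1 (+-mono-≤ degS′l≤1 IH) ⟩
      1 + (1 + 2 * k)                             ≡⟨ *-distribˡ-+ 2 1 k ⟨
      2 * suc k                                   ∎
      where
      open ≤-Reasoning
      degS′l≤1 : degIn S′ l ≤ 1
      degS′l≤1 = subst (_≤ 1) (trans (degIn-∷ S↭ l) (cong (λ e → hasEdge e + degIn S′ l) (loopless G l))) degl≤1
      IH : ∑ S′ (degIn S′) ≤ 2 * k
      IH = handshake-acyclic k (Unique-tail-↭ uS S↭) (suc-injective (trans (sym (↭-length S↭)) |S|≡))

isPos isNeg : Maybe Sign → ℕ
isPos (just pos) = 1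
isPos _          = 0
isNeg (just neg) = 1
isNeg _          = 0

hasEdge≡isPos+isNeg : ∀ e → hasEdge e ≡ isPos e + isNeg e
hasEdge≡isPos+isNeg nothing    = refl
hasEdge≡isPos+isNeg (just pos) = refl
hasEdge≡isPos+isNeg (just neg) = refl

signedSum-balance-∷ : ∀ e r n p → r ℤ.+ + n ≡ + p →
                      (contrib e ℤ.+ r) ℤ.+ + (isNeg e + n) ≡ + (isPos e + p)
signedSum-balance-∷ nothing    r n p eq = trans (cong (λ z → z ℤ.+ + n) (ℤ.+-identityˡ r)) eq
signedSum-balance-∷ (just pos) r n p eq = trans (ℤ.+-assoc 1ℤ r (+ n)) (cong (λ z → 1ℤ ℤ.+ z) eq)
signedSum-balance-∷ (just neg) r n p eq = trans (cancel r (+ n)) eq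
  where
  cancel : ∀ r n → (ℤ.- 1ℤ ℤ.+ r) ℤ.+ (1ℤ ℤ.+ n) ≡ r ℤ.+ n
  cancel = solve-∀

signedSum-balance : ∀ {A : Set} (es : A → Maybe Sign) xs →
  foldr ℤ._+_ 0ℤ (map (contrib ∘ es) xs) ℤ.+ + ∑ xs (isNeg ∘ es) ≡ + ∑ xs (isPos ∘ es)
signedSum-balance es []       = refl
signedSum-balance es (x ∷ xs) = signedSum-balance-∷ (es x) _ _ _ (signedSum-balance es xs)

module _ {m} (G : SignedGraph m) where

  posDeg negDeg : Fin m → ℕ
  posDeg v = ∑ (allFin m) (isPos ∘ edge G v)
  negDeg v = ∑ (allFin m) (isNeg ∘ edge G v)

  posDeg≡sdeg+negDeg : ∀ {v k} → sdeg G v ≡ + k → posDeg v ≡ k + negDeg v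
  posDeg≡sdeg+negDeg {v} {k} sdeg≡k = sym (ℤ.+-injective (begin
    + k ℤ.+ + negDeg v      ≡⟨ cong (λ z → z ℤ.+ + negDeg v) sdeg≡k ⟨
    sdeg G v ℤ.+ + negDeg v ≡⟨ signedSum-balance (edge G v) (allFin m) ⟩
    + posDeg v              ∎))
    where open ≡-Reasoning

  deg≡sdeg+2negDeg : ∀ {v k} → sdeg G v ≡ + k → deg G v ≡ k + negDeg v + negDeg v
  deg≡sdeg+2negDeg {v} {k} sdeg≡k = begin
    deg G v
      ≡⟨ ∑-cong (allFin m) (hasEdge≡isPos+isNeg ∘ edge G v) ⟩
    ∑ (allFin m) (λ w → isPos (edge G v w) + isNeg (edge G v w))
      ≡⟨ ∑-+ (allFin m) (isPos ∘ edge G v) (isNeg ∘ edge G v) ⟩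
    posDeg v + negDeg v
      ≡⟨ cong (_+ negDeg v) (posDeg≡sdeg+negDeg sdeg≡k) ⟩
    k + negDeg v + negDeg v
      ∎
    where open ≡-Reasoning

  ∑negDeg≥2 : ∀ {w} → 0 < negDeg w → 2 ≤ ∑ (allFin m) negDeg
  ∑negDeg≥2 {w} 0<negw with u , _ , 0<isNeg ← ∑-pos (allFin m) (isNeg ∘ edge G w) 0<negw =
    ≤-trans (+-mono-≤ 0<negw (≤-trans 0<negu (m≤m+n _ 0)))
            (∑-mono-⊆ negDeg ((w≢u ∷ []) ∷ [] ∷ []) (Unique.allFin⁺ m) (λ _ → ∈-allFin _))
    where
    neg-edge : ∀ e → 0 < isNeg e → e ≡ just neg
    neg-edge (just neg) _ = refl
    wu≡neg : edge G w u ≡ just neg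
    wu≡neg = neg-edge (edge G w u) 0<isNeg
    0<negu : 0 < negDeg u
    0<negu = ≤-trans (subst (λ e → 0 < isNeg e) (sym (trans (symmetric G u w) wu≡neg)) (s≤s z≤n))
                     (∈⇒≤∑ (isNeg ∘ edge G u) (∈-allFin w))
    w≢u : w ≢ u
    w≢u refl = ¬Adj-refl G (neg , wu≡neg)

-- The lower bound

vertex-bound-arith : ∀ k n → 0 < k + n + n → 1 + (k ∸ 1) + n ≤ k + n + n
vertex-bound-arith zero    zero    ()
vertex-bound-arith zero    (suc n) _ = s≤s (m≤n+m (suc n) n)
vertex-bound-arith (suc k) n       _ = s≤s (m≤m+n (k + n) n)

order-bound-arith : ∀ m′ A B D → suc m′ + A + B ≤ D → D ≤ 2 * m′ → 2 ≤ B → 4 + A ≤ suc m′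
order-bound-arith m′ A B D lower upper 2≤B = s≤s (+-cancelˡ-≤ m′ (3 + A) m′ (begin
  m′ + (3 + A)   ≡⟨ reorder m′ A ⟩
  suc m′ + A + 2 ≤⟨ +-monoʳ-≤ (suc m′ + A) 2≤B ⟩
  suc m′ + A + B ≤⟨ lower ⟩
  D              ≤⟨ upper ⟩
  2 * m′         ≡⟨ double m′ ⟩
  m′ + m′        ∎))
  where
  open ≤-Reasoning
  reorder : ∀ m′ A → m′ + (3 + A) ≡ suc m′ + A + 2
  reorder = solve-∀ℕ
  double : ∀ m′ → 2 * m′ ≡ m′ + m′
  double = solve-∀ℕ

signedTree-order-bound : ∀ {m} (T : SignedTree m) → let G = graph T in
  (∀ v → sdeg G v ≡ + ∣ sdeg G v ∣) → (∀ v → 0 < deg G v) → ∀ {w} → sdeg G w ≡ 0ℤ →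
  4 + ∑ (allFin m) (λ v → ∣ sdeg G v ∣ ∸ 1) ≤ m
signedTree-order-bound {suc m′} T sdeg≥0 0<deg {w} sdeg-w≡0 =
  order-bound-arith m′ (∑ V (λ v → ∣ sdeg G v ∣ ∸ 1)) (∑ V (negDeg G)) (∑ V (deg G))
    ∑deg≥ (handshake-acyclic G (acyclic T) m′ (Unique.allFin⁺ (suc m′)) (length-tabulate id))
    (∑negDeg≥2 G 0<negDeg-w)
  where
  G = graph T
  V = allFin (suc m′)
  deg≡ : ∀ v → deg G v ≡ ∣ sdeg G v ∣ + negDeg G v + negDeg G v
  deg≡ v = deg≡sdeg+2negDeg G (sdeg≥0 v)
  0<negDeg-w : 0 < negDeg G w
  0<negDeg-w with negDeg G w | 0<deg w | deg≡sdeg+2negDeg G sdeg-w≡0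
  ... | suc _ | _      | _     = s≤s z≤n
  ... | zero  | 0<degw | deg≡0 = ⊥-elim (<⇒≢ 0<degw (sym deg≡0))
  vertex-bound : ∀ v → 1 + (∣ sdeg G v ∣ ∸ 1) + negDeg G v ≤ deg G v
  vertex-bound v = subst (1 + (∣ sdeg G v ∣ ∸ 1) + negDeg G v ≤_) (sym (deg≡ v))
    (vertex-bound-arith ∣ sdeg G v ∣ (negDeg G v) (subst (0 <_) (deg≡ v) (0<deg v)))
  |V|≡∑1 : suc m′ ≡ ∑ V (λ _ → 1)
  |V|≡∑1 = trans (sym (length-tabulate id)) (sym (∑-1≡length V))
  ∑deg≥ : suc m′ + ∑ V (λ v → ∣ sdeg G v ∣ ∸ 1) + ∑ V (negDeg G) ≤ ∑ V (deg G)
  ∑deg≥ = begin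
    suc m′ + ∑ V (λ v → ∣ sdeg G v ∣ ∸ 1) + ∑ V (negDeg G)
      ≡⟨ cong (λ l → l + ∑ V (λ v → ∣ sdeg G v ∣ ∸ 1) + ∑ V (negDeg G)) |V|≡∑1 ⟩
    ∑ V (λ _ → 1) + ∑ V (λ v → ∣ sdeg G v ∣ ∸ 1) + ∑ V (negDeg G)
      ≡⟨ cong (_+ ∑ V (negDeg G)) (∑-+ V (λ _ → 1) (λ v → ∣ sdeg G v ∣ ∸ 1)) ⟨
    ∑ V (λ v → 1 + (∣ sdeg G v ∣ ∸ 1)) + ∑ V (negDeg G)
      ≡⟨ ∑-+ V (λ v → 1 + (∣ sdeg G v ∣ ∸ 1)) (negDeg G) ⟨
    ∑ V (λ v → 1 + (∣ sdeg G v ∣ ∸ 1) + negDeg G v)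
      ≤⟨ ∑-mono-≤ V vertex-bound ⟩
    ∑ V (deg G)
      ∎
    where open ≤-Reasoning

module _ {n} (x : Vector ℕ n) where

  DSet-nonneg : ∀ {d} → DSet x d → d ≡ + ∣ d ∣
  DSet-nonneg (inj₁ refl)              = refl
  DSet-nonneg (inj₂ (inj₁ refl))       = refl
  DSet-nonneg (inj₂ (inj₂ (_ , refl))) = refl

  realization-order-bound : Injective _≡_ _≡_ x → ∀ {m} (T : SignedTree m) → Realizes T (DSet x) →
                            4 + ∑ (allFin n) (λ i → x i ∸ 1) ≤ m
  realization-order-bound x-inj {m} T (in-D , covers) =
    ≤-trans (+-monoʳ-≤ 4 ∑x≤∑sdeg)
      (signedTree-order-bound T (DSet-nonneg ∘ in-D)
        (connected⇒0<deg G (connected T) zero≢one) (proj₂ (covers 0ℤ zero∈D)))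
    where
    G = graph T
    zero∈D : DSet x 0ℤ
    zero∈D = inj₂ (inj₁ refl)
    zero≢one : proj₁ (covers 0ℤ zero∈D) ≢ proj₁ (covers 1ℤ (inj₁ refl))
    zero≢one eq with () ← trans (sym (proj₂ (covers 0ℤ zero∈D)))
                                (trans (cong (sdeg G) eq) (proj₂ (covers 1ℤ (inj₁ refl))))
    vertexOf : Fin n → Fin m
    vertexOf i = proj₁ (covers (+ x i) (inj₂ (inj₂ (i , refl))))
    ∣sdeg-vertexOf∣ : ∀ i → ∣ sdeg G (vertexOf i) ∣ ≡ x i
    ∣sdeg-vertexOf∣ i = cong ∣_∣ (proj₂ (covers (+ x i) (inj₂ (inj₂ (i , refl)))))
    vertexOf-inj : ∀ {i j} → vertexOf i ≡ vertexOf j → i ≡ j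
    vertexOf-inj {i} {j} eq =
      x-inj (trans (sym (∣sdeg-vertexOf∣ i)) (trans (cong (∣_∣ ∘ sdeg G) eq) (∣sdeg-vertexOf∣ j)))
    ∑x≤∑sdeg : ∑ (allFin n) (λ i → x i ∸ 1) ≤ ∑ (allFin m) (λ v → ∣ sdeg G v ∣ ∸ 1)
    ∑x≤∑sdeg = begin
      ∑ (allFin n) (λ i → x i ∸ 1)
        ≡⟨ ∑-cong (allFin n) (λ i → cong (_∸ 1) (∣sdeg-vertexOf∣ i)) ⟨
      ∑ (allFin n) (λ i → ∣ sdeg G (vertexOf i) ∣ ∸ 1)
        ≡⟨ ∑-map vertexOf (allFin n) _ ⟨
      ∑ (map vertexOf (allFin n)) (λ v → ∣ sdeg G v ∣ ∸ 1)
        ≤⟨ ∑-mono-⊆ _ (Unique.map⁺ vertexOf-inj (Unique.allFin⁺ n)) (Unique.allFin⁺ m) (λ _ → ∈-allFin _) ⟩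
      ∑ (allFin m) (λ v → ∣ sdeg G v ∣ ∸ 1)
        ∎
      where open ≤-Reasoning

-- Attaching a pendant vertex

leafEdge : ∀ {m} → Fin m → Sign → Fin m → Maybe Sign
leafEdge zero    s zero    = just s
leafEdge zero    s (suc _) = nothing
leafEdge (suc _) s zero    = nothing
leafEdge (suc a) s (suc w) = leafEdge a s w

leafEdge-self : ∀ {m} (a : Fin m) s → leafEdge a s a ≡ just s
leafEdge-self zero    s = refl
leafEdge-self (suc a) s = leafEdge-self a s

leafEdge-other : ∀ {m} (a w : Fin m) s → w ≢ a → leafEdge a s w ≡ nothing
leafEdge-other zero    zero    s w≢a = ⊥-elim (w≢a refl)
leafEdge-other zero    (suc w) s _   = refl
leafEdge-other (suc a) zero    s _   = refl
leafEdge-other (suc a) (suc w) s w≢a = leafEdge-other a w s (w≢a ∘ cong suc)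

leafEdge-just : ∀ {m} (a w : Fin m) s {s′} → leafEdge a s w ≡ just s′ → w ≡ a
leafEdge-just zero    zero    s _  = refl
leafEdge-just (suc a) (suc w) s eq = cong suc (leafEdge-just a w s eq)

sumℤ-zeros : ∀ m → foldr ℤ._+_ 0ℤ (tabulate {n = m} (λ _ → 0ℤ)) ≡ 0ℤ
sumℤ-zeros zero    = refl
sumℤ-zeros (suc m) = cong (λ z → 0ℤ ℤ.+ z) (sumℤ-zeros m)

sumℤ-leafEdge : ∀ {m} (a : Fin m) s → foldr ℤ._+_ 0ℤ (tabulate (contrib ∘ leafEdge a s)) ≡ signValue s
sumℤ-leafEdge {suc m} zero    s = trans (cong (λ z → signValue s ℤ.+ z) (sumℤ-zeros m)) (ℤ.+-identityʳ _)
sumℤ-leafEdge {suc m} (suc a) s = trans (ℤ.+-identityˡ _) (sumℤ-leafEdge a s)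

sdeg-tabulate : ∀ {m} (G : SignedGraph m) v → sdeg G v ≡ foldr ℤ._+_ 0ℤ (tabulate (contrib ∘ edge G v))
sdeg-tabulate G v = cong (foldr ℤ._+_ 0ℤ) (map-tabulate id (contrib ∘ edge G v))

-- The new vertex is zero; vertex i of G becomes suc i.
addLeaf : ∀ {m} → SignedGraph m → Fin m → Sign → SignedGraph (suc m)
addLeaf {m} G a s = record { edge = edge′ ; symmetric = symmetric′ ; loopless = loopless′ }
  where
  edge′ : Fin (suc m) → Fin (suc m) → Maybe Sign
  edge′ zero    zero    = nothing
  edge′ zero    (suc j) = leafEdge a s j
  edge′ (suc i) zero    = leafEdge a s i
  edge′ (suc i) (suc j) = edge G i j
  symmetric′ : ∀ i j → edge′ i j ≡ edge′ j i
  symmetric′ zero    zero    = refl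
  symmetric′ zero    (suc j) = refl
  symmetric′ (suc i) zero    = refl
  symmetric′ (suc i) (suc j) = symmetric G i j
  loopless′ : ∀ i → edge′ i i ≡ nothing
  loopless′ zero    = refl
  loopless′ (suc i) = loopless G i

module _ {m} (G : SignedGraph m) (a : Fin m) (s : Sign) where

  private
    G′ = addLeaf G a s

  open import Data.List.Membership.DecPropositional (_≟_ {suc m}) using (_∈?_)

  addLeaf-Adj : Adj G′ zero (suc a)
  addLeaf-Adj = s , leafEdge-self a s

  addLeaf-Adj⁻ : ∀ {y} → Adj G′ zero y → y ≡ suc a
  addLeaf-Adj⁻ {suc w} (_ , eq) = cong suc (leafEdge-just a w s eq)

  liftWalk : ∀ {i j} → Walk G i j → Walk G′ (suc i) (suc j)
  liftWalk (here v)       = here (suc v)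
  liftWalk (step adj wlk) = step adj (liftWalk wlk)

  addLeaf-connected : Connected G → Connected G′
  addLeaf-connected conn zero    zero    = here zero
  addLeaf-connected conn zero    (suc j) = step addLeaf-Adj (liftWalk (conn a j))
  addLeaf-connected conn (suc i) zero    =
    Walk-++ G′ (liftWalk (conn i a)) (step (Adj-sym G′ {zero} {suc a} addLeaf-Adj) (here zero))
  addLeaf-connected conn (suc i) (suc j) = liftWalk (conn i j)

  lowerChain : ∀ xs → Chain G′ (map suc xs) → Chain G xs
  lowerChain []           _              = nil
  lowerChain (x ∷ [])     _              = one x
  lowerChain (x ∷ y ∷ xs) (cons adj chn) = cons adj (lowerChain (y ∷ xs) chn)

  lowerAll : ∀ (xs : List (Fin (suc m))) → All (zero ≢_) xs → ∃[ ys ] (xs ≡ map suc ys)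
  lowerAll []           []            = [] , refl
  lowerAll (zero ∷ xs)  (0≢0 ∷ _)     = ⊥-elim (0≢0 refl)
  lowerAll (suc y ∷ xs) (_ ∷ nonzero) with ys , refl ← lowerAll xs nonzero = y ∷ ys , refl

  lowerCycle : (C : Cycle G′) → All (zero ≢_) (cycleVertices G′ C) → Cycle G
  lowerCycle record { first = zero } (0≢0 ∷ _) = ⊥-elim (0≢0 refl)
  lowerCycle record { first = suc f ; middle = mid ; last = l ; long = long
                    ; distinct = distinct ; chain = chain ; closing = closing } (_ ∷ nonzero)
    with mid′ , refl ← lowerAll mid (++⁻ˡ mid nonzero)
    with l | All.head (++⁻ʳ mid nonzero)
  ... | zero   | 0≢0 = ⊥-elim (0≢0 refl)
  ... | suc l′ | _   = record
    { first    = f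
    ; middle   = mid′
    ; last     = l′
    ; long     = subst (1 ≤_) (length-map suc mid′) long
    ; distinct = Unique.map⁻ (subst Unique lift distinct)
    ; chain    = lowerChain (f ∷ mid′ ++ [ l′ ]) (subst (Chain G′) lift chain)
    ; closing  = closing
    }
    where
    lift : suc f ∷ map suc mid′ ++ [ suc l′ ] ≡ map suc (f ∷ mid′ ++ [ l′ ])
    lift = cong (suc f ∷_) (sym (map-++ suc mid′ [ l′ ]))

  addLeaf-acyclic : Acyclic G → Acyclic G′
  addLeaf-acyclic acyc C with zero ∈? cycleVertices G′ C
  ... | yes 0∈ with p , q , p≢q , adjp , adjq ← cycle-twoNeighbours G′ C 0∈ =
    p≢q (trans (addLeaf-Adj⁻ adjp) (sym (addLeaf-Adj⁻ adjq)))
  ... | no 0∉ = acyc (lowerCycle C (¬Any⇒All¬ _ 0∉))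

  sdeg-addLeaf-new : sdeg G′ zero ≡ signValue s
  sdeg-addLeaf-new = trans (sdeg-tabulate G′ zero) (trans (ℤ.+-identityˡ _) (sumℤ-leafEdge a s))

  sdeg-addLeaf-old : ∀ v → sdeg G′ (suc v) ≡ contrib (leafEdge a s v) ℤ.+ sdeg G v
  sdeg-addLeaf-old v =
    trans (sdeg-tabulate G′ (suc v)) (cong (λ z → contrib (leafEdge a s v) ℤ.+ z) (sym (sdeg-tabulate G v)))

  sdeg-addLeaf-anchor : sdeg G′ (suc a) ≡ signValue s ℤ.+ sdeg G a
  sdeg-addLeaf-anchor = trans (sdeg-addLeaf-old a) (cong (λ e → contrib e ℤ.+ sdeg G a) (leafEdge-self a s))

  sdeg-addLeaf-other : ∀ {v} → v ≢ a → sdeg G′ (suc v) ≡ sdeg G v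
  sdeg-addLeaf-other {v} v≢a = trans (sdeg-addLeaf-old v)
    (trans (cong (λ e → contrib e ℤ.+ sdeg G v) (leafEdge-other a v s v≢a)) (ℤ.+-identityˡ _))

addLeafTree : ∀ {m} → SignedTree m → Fin m → Sign → SignedTree (suc m)
addLeafTree T a s = record
  { graph     = addLeaf (graph T) a s
  ; connected = addLeaf-connected (graph T) a s (connected T)
  ; acyclic   = addLeaf-acyclic (graph T) a s (acyclic T)
  }

singletonTree : SignedTree 1
singletonTree = record
  { graph     = G₁
  ; connected = λ { zero zero → here zero }
  ; acyclic   = λ C → no-edge (Cycle.middle C) (Cycle.long C) (Cycle.chain C)
  }
  where
  G₁ : SignedGraph 1
  G₁ = record { edge = λ _ _ → nothing ; symmetric = λ _ _ → refl ; loopless = λ _ → refl }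
  no-edge : ∀ {f l} mid → 1 ≤ length mid → ¬ Chain G₁ (f ∷ mid ++ [ l ])
  no-edge (_ ∷ _) _ (cons (_ , ()) _)

-- The upper bound

module _ (D : ℤ → Set) where

  -- Pendant vertices are only ever attached at the port, so attaching one changes no other
  -- signed degree.
  record PortedRealization {m} (T : SignedTree m) (port : Fin m) (c : ℤ) (Q : ℤ → Set) : Set where
    field
      inD       : ∀ v → v ≢ port → D (sdeg (graph T) v)
      sdeg-port : sdeg (graph T) port ≡ c
      covers    : ∀ {d} → Q d → ∃[ v ] (v ≢ port × sdeg (graph T) v ≡ d)

  open PortedRealization

  singletonTree-realization : PortedRealization singletonTree zero 0ℤ (λ _ → ⊥)
  singletonTree-realization = record
    { inD = λ { zero 0≢0 → ⊥-elim (0≢0 refl) } ; sdeg-port = refl ; covers = λ () }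

  module _ {m} {T : SignedTree m} {p : Fin m} {c : ℤ} {Q : ℤ → Set} (R : PortedRealization T p c Q) where

    private
      sdeg′ : Sign → Fin (suc m) → ℤ
      sdeg′ s = sdeg (addLeaf (graph T) p s)

      sdeg-old-port : ∀ s → sdeg′ s (suc p) ≡ signValue s ℤ.+ c
      sdeg-old-port s = trans (sdeg-addLeaf-anchor (graph T) p s) (cong (λ z → signValue s ℤ.+ z) (sdeg-port R))

      covers-old : ∀ s {d} → Q d → ∃[ v ] (v ≢ suc p × v ≢ zero × sdeg′ s v ≡ d)
      covers-old s Qd with v , v≢p , sdeg≡d ← covers R Qd =
        suc v , v≢p ∘ Fin.suc-injective , (λ ()) , trans (sdeg-addLeaf-other (graph T) p s v≢p) sdeg≡d

    PortedRealization-mono : ∀ {Q′ : ℤ → Set} → (∀ {d} → Q′ d → Q d) → PortedRealization T p c Q′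
    PortedRealization-mono Q′⊆Q = record { inD = inD R ; sdeg-port = sdeg-port R ; covers = covers R ∘ Q′⊆Q }

    growPort : ∀ s → D (signValue s) → PortedRealization (addLeafTree T p s) (suc p) (signValue s ℤ.+ c) Q
    growPort s D-s = record
      { inD       = inD′
      ; sdeg-port = sdeg-old-port s
      ; covers    = λ Qd → let v , v≢p , _ , sdeg≡d = covers-old s Qd in v , v≢p , sdeg≡d
      }
      where
      inD′ : ∀ v → v ≢ suc p → D (sdeg′ s v)
      inD′ zero    _     = subst D (sym (sdeg-addLeaf-new (graph T) p s)) D-s
      inD′ (suc v) sv≢sp =
        subst D (sym (sdeg-addLeaf-other (graph T) p s (sv≢sp ∘ cong suc))) (inD R v (sv≢sp ∘ cong suc))

    movePort : ∀ s → D (signValue s ℤ.+ c) →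
               PortedRealization (addLeafTree T p s) zero (signValue s) (λ d → Q d ⊎ d ≡ signValue s ℤ.+ c)
    movePort s D-s+c = record
      { inD       = inD′
      ; sdeg-port = sdeg-addLeaf-new (graph T) p s
      ; covers    = covers′
      }
      where
      inD′ : ∀ v → v ≢ zero → D (sdeg′ s v)
      inD′ zero    0≢0 = ⊥-elim (0≢0 refl)
      inD′ (suc v) _ with v ≟ p
      ... | yes refl = subst D (sym (sdeg-old-port s)) D-s+c
      ... | no  v≢p  = subst D (sym (sdeg-addLeaf-other (graph T) p s v≢p)) (inD R v v≢p)
      covers′ : ∀ {d} → Q d ⊎ d ≡ signValue s ℤ.+ c → ∃[ v ] (v ≢ zero × sdeg′ s v ≡ d)
      covers′ (inj₁ Qd) = let v , _ , v≢0 , sdeg≡d = covers-old s Qd in v , v≢0 , sdeg≡d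
      covers′ (inj₂ d≡) = suc p , (λ ()) , trans (sdeg-old-port s) (sym d≡)

  growPort-pos-many : ∀ k {m} {T : SignedTree m} {p j Q} → D 1ℤ → PortedRealization T p (+ j) Q →
                      Σ (SignedTree (k + m)) λ T′ → Σ (Fin (k + m)) λ p′ → PortedRealization T′ p′ (+ (k + j)) Q
  growPort-pos-many zero    {T = T} {p} D-1 R = T , p , R
  growPort-pos-many (suc k) D-1 R with T′ , p′ , R′ ← growPort-pos-many k D-1 R =
    addLeafTree T′ p′ pos , suc p′ , growPort R′ pos D-1

  PortedRealization⇒Realizes : ∀ {m} {T : SignedTree m} {p c} → D c → PortedRealization T p c D → Realizes T D
  PortedRealization⇒Realizes {T = T} {p} D-c R = inD′ , λ d Dd → let v , _ , sdeg≡d = covers R Dd in v , sdeg≡d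
    where
    inD′ : ∀ v → D (sdeg (graph T) v)
    inD′ v with v ≟ p
    ... | yes refl = subst D (sym (sdeg-port R)) D-c
    ... | no v≢p   = inD R v v≢p

suc[∸2+1] : ∀ {y} → 1 < y → suc ((y ∸ 2) + 1) ≡ y
suc[∸2+1] {suc zero}    (s≤s ())
suc[∸2+1] {suc (suc y)} _         = cong suc (+-comm y 1)

caterpillar-order-step : ∀ {y} S → 1 < y → suc ((y ∸ 2) + (4 + S)) ≡ 4 + ((y ∸ 1) + S)
caterpillar-order-step {suc zero}    S (s≤s ())
caterpillar-order-step {suc (suc y)} S _ = reorder y S
  where
  reorder : ∀ y S → suc (y + (4 + S)) ≡ 4 + (suc y + S)
  reorder = solve-∀ℕ

module _ {n} (x : Vector ℕ n) (1<x : ∀ i → 1 < x i) where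

  Covered : List (Fin n) → ℤ → Set
  Covered L d = d ≡ 1ℤ ⊎ d ≡ 0ℤ ⊎ ∃[ i ] (i ∈ L × d ≡ + x i)

  record Caterpillar (L : List (Fin n)) : Set where
    field
      order       : ℕ
      tree        : SignedTree order
      port        : Fin order
      realization : PortedRealization (DSet x) tree port 1ℤ (Covered L)
      order≡      : order ≡ 4 + ∑ L (λ i → x i ∸ 1)

  caterpillar-[] : Caterpillar []
  caterpillar-[] = record
    { order       = 4
    ; tree        = _
    ; port        = zero
    ; realization = PortedRealization-mono (DSet x) path₃ cover
    ; order≡      = refl
    }
    where
    path₁ = movePort (DSet x) (singletonTree-realization (DSet x)) pos (inj₁ refl)
    path₂ = movePort (DSet x) path₁ neg (inj₂ (inj₁ refl))
    path₃ = movePort (DSet x) path₂ pos (inj₂ (inj₁ refl))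
    cover : ∀ {d} → Covered [] d → ((⊥ ⊎ d ≡ 1ℤ) ⊎ d ≡ 0ℤ) ⊎ d ≡ 0ℤ
    cover (inj₁ d≡1)        = inj₁ (inj₁ (inj₂ d≡1))
    cover (inj₂ (inj₁ d≡0)) = inj₂ d≡0

  caterpillar-∷ : ∀ i {L} → Caterpillar L → Caterpillar (i ∷ L)
  caterpillar-∷ i {L} C
    with T′ , p′ , R′ ← growPort-pos-many (DSet x) (x i ∸ 2) (inj₁ refl) (Caterpillar.realization C) = record
    { order       = _
    ; tree        = addLeafTree T′ p′ pos
    ; port        = zero
    ; realization = PortedRealization-mono (DSet x) (movePort (DSet x) R′ pos x-i∈D) cover
    ; order≡      = trans (cong (λ k → suc ((x i ∸ 2) + k)) (Caterpillar.order≡ C))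
                          (caterpillar-order-step _ (1<x i))
    }
    where
    x-i≡ : + x i ≡ 1ℤ ℤ.+ + ((x i ∸ 2) + 1)
    x-i≡ = cong +_ (sym (suc[∸2+1] (1<x i)))
    x-i∈D : DSet x (1ℤ ℤ.+ + ((x i ∸ 2) + 1))
    x-i∈D = inj₂ (inj₂ (i , sym x-i≡))
    cover : ∀ {d} → Covered (i ∷ L) d → Covered L d ⊎ d ≡ 1ℤ ℤ.+ + ((x i ∸ 2) + 1)
    cover (inj₁ d≡1)                         = inj₁ (inj₁ d≡1)
    cover (inj₂ (inj₁ d≡0))                  = inj₁ (inj₂ (inj₁ d≡0))
    cover (inj₂ (inj₂ (j , here refl , d≡))) = inj₂ (trans d≡ x-i≡)
    cover (inj₂ (inj₂ (j , there j∈ , d≡)))  = inj₁ (inj₂ (inj₂ (j , j∈ , d≡)))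

  caterpillar : ∀ L → Caterpillar L
  caterpillar []      = caterpillar-[]
  caterpillar (i ∷ L) = caterpillar-∷ i (caterpillar L)

  caterpillar-realizes : Realizes (Caterpillar.tree (caterpillar (allFin n))) (DSet x)
  caterpillar-realizes = PortedRealization⇒Realizes (DSet x) (inj₁ refl)
    (PortedRealization-mono (DSet x) (Caterpillar.realization (caterpillar (allFin n))) DSet⊆Covered)
    where
    DSet⊆Covered : ∀ {d} → DSet x d → Covered (allFin n) d
    DSet⊆Covered (inj₁ d≡1)             = inj₁ d≡1
    DSet⊆Covered (inj₂ (inj₁ d≡0))      = inj₂ (inj₁ d≡0)
    DSet⊆Covered (inj₂ (inj₂ (i , d≡))) = inj₂ (inj₂ (i , ∈-allFin i , d≡))

order-formula : ∀ {n} (x : Vector ℕ n) → (∀ i → 0 < x i) →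
                4 + ∑ (allFin n) (λ i → x i ∸ 1) ≡ (4 + sumVec x) ∸ n
order-formula {n} x 0<x = begin
  4 + A                           ≡⟨ m+n∸n≡m (4 + A) n ⟨
  4 + A + n ∸ n                   ≡⟨ cong (_∸ n) (+-assoc 4 A n) ⟩
  4 + (A + n) ∸ n                 ≡⟨ cong (λ k → 4 + (A + k) ∸ n) (length-tabulate id) ⟨
  4 + (A + length (allFin n)) ∸ n ≡⟨ cong (λ k → 4 + k ∸ n) (∑-∸1+length (allFin n) x 0<x) ⟩
  4 + sumVec x ∸ n                ∎
  where
  open ≡-Reasoning
  A = ∑ (allFin n) (λ i → x i ∸ 1)

mainTheorem11 : (n : ℕ) → 1 ≤ n → (x : Vector ℕ n) → Injective _≡_ _≡_ x → (∀ i → 1 < x i)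
    → σ-is (DSet x) ((4 + sumVec x) ∸ n)
mainTheorem11 n _ x x-inj 1<x =
  subst (λ k → Σ (SignedTree k) λ T → Realizes T (DSet x)) (trans order≡ formula)
        (tree , caterpillar-realizes x 1<x) ,
  λ m T realizes → subst (_≤ m) formula (realization-order-bound x x-inj T realizes)
  where
  open Caterpillar (caterpillar x 1<x (allFin n))
  formula = order-formula x (λ i → <⇒≤ (1<x i))
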